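{- Let $P$ be a finite set of $n$ points partitioned into groups $\mathbf{g}_1,\dots,\mathbf{g}_k$, and let $h:P\to\{1,\dots,m\}$. For bucket $j$ let $n_j$ be the number of points of $P$ mapped to $j$ and $\alpha_{i,j}$ the number of points of $\mathbf{g}_i$ mapped to $j$. Say $h$ satisfies pairwise fairness if $\sum_{j=1}^m (\alpha_{i,j}/|\mathbf{g}_i|)^2=\frac1m$ for every $i$; single fairness if $\sum_{j=1}^m \frac{\alpha_{i,j}}{|\mathbf{g}_i|}\frac{n_j}{n}=\frac1m$ for every $i$; and collision probability if $\sum_{j=1}^m (n_j/n)^2=\frac1m$. Then: (1) $h$ satisfies pairwise fairness if and only if $\alpha_{i,j}=\frac{|\mathbf{g}_i|}{m}$ for every $i\in\{1,\dots,k\}$ and every $j\in\{1,\dots,m\}$; (2) if $h$ satisfies pairwise fairness then it satisfies both single fairness and collision probability; (3) the converse of (2) does not hold in general: there exist $P$, groups and $h$ satisfying collision probability and single fairness but not pairwise fairness.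
   Context: These quantities are probabilities: collision probability is $\Pr[h(p)=h(q)]$ for $p,q$ independent uniform from $P$; single fairness of group $i$ is $\Pr[h(p)=h(x)]$ for $p$ uniform in $\mathbf{g}_i$, $x$ independent uniform in $P$; pairwise fairness of group $i$ is $\Pr[h(p)=h(q)]$ for $p,q$ independent uniform in $\mathbf{g}_i$. Standing assumption of the paper: $m$ divides $|\mathbf{g}_i|$ for every $i$. -}

module Defs where

open import Data.Nat using (ℕ; zero; suc)
open import Data.Fin using (Fin; zero; suc)
open import Data.Fin.Properties using () renaming (_≟_ to _≟ᶠ_)
open import Data.Bool using (Bool; true; false; if_then_else_; _∧_)
open import Data.Integer using (+_)
open import Data.Rational using (ℚ; _/_; 0ℚ; _+_; _*_)
open import Relation.Nullary.Decidable using (⌊_⌋)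
open import Relation.Binary.PropositionalEquality using (_≡_)

countF : ∀ {n} → (Fin n → Bool) → ℕ
countF {zero}  P = 0
countF {suc n} P = (if P zero then 1 else 0) Data.Nat.+ countF (λ x → P (suc x))

sumQ : ∀ {m} → (Fin m → ℚ) → ℚ
sumQ {zero}  f = 0ℚ
sumQ {suc m} f = f zero + sumQ (λ j → f (suc j))

-- the fraction a / b as a rational; denominator 0 is never used in the
-- statement (all denominators are proven/assumed positive); we set it to 0.
frac : ℕ → ℕ → ℚ
frac a zero    = 0ℚ
frac a (suc b) = (+ a) / suc b

-- Setting: points P = Fin n, group assignment g : Fin n → Fin k
-- (group i is g⁻¹(i)), hash h : Fin n → Fin m (buckets Fin m).
module Hashing {n k m : ℕ} (g : Fin n → Fin k) (h : Fin n → Fin m) where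

  size : Fin k → ℕ
  size i = countF (λ p → ⌊ g p ≟ᶠ i ⌋)

  nb : Fin m → ℕ
  nb j = countF (λ p → ⌊ h p ≟ᶠ j ⌋)

  α : Fin k → Fin m → ℕ
  α i j = countF (λ p → ⌊ g p ≟ᶠ i ⌋ ∧ ⌊ h p ≟ᶠ j ⌋)

  PairwiseFair : Set
  PairwiseFair = ∀ i → sumQ (λ j → frac (α i j) (size i) * frac (α i j) (size i)) ≡ frac 1 m

  SingleFair : Set
  SingleFair = ∀ i → sumQ (λ j → frac (α i j) (size i) * frac (nb j) n) ≡ frac 1 m

  CollisionProb : Set
  CollisionProb = sumQ (λ j → frac (nb j) n * frac (nb j) n) ≡ frac 1 m

-- With s = |gᵢ|, every fairness quantity is a sum of products of fractions with
-- a common denominator, so it equals 1/m exactly when an identity of natural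
-- numbers holds. Pairwise fairness of gᵢ becomes m · Σⱼ αᵢⱼ² = s², and since
-- Σⱼ (m αᵢⱼ − s)² = m (m Σⱼ αᵢⱼ² − s²) this is the equality case of
-- Cauchy–Schwarz, forcing m αᵢⱼ = s for every j. If every group is spread
-- evenly then so is P (m nⱼ = n), and m Σⱼ aⱼ nⱼ = n Σⱼ aⱼ for any weights aⱼ
-- gives single fairness and collision probability. Two groups hashed each into its own
-- bucket show that the converse fails.
module Submission where

open import Defs
open import Data.Bool using (Bool; true; false; if_then_else_; _∧_)
open import Data.Bool.Properties using (∧-comm)
open import Data.Fin using (Fin; zero; suc; fromℕ<)
open import Data.Fin.Patterns using (0F; 1F; 2F; 3F)
open import Data.Fin.Properties using (_≟_)
import Data.Integer as ℤ
open import Data.Integer.Properties using (pos-*; pos-+)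
import Data.Integer.Tactic.RingSolver as ℤ-Solver
open import Data.Nat using (ℕ; zero; suc; _+_; _*_; ∣_-_∣; _<_; z<s)
open import Data.Nat.Divisibility using (_∣_; divides; 0∣⇒≡0)
open import Data.Nat.Properties
  using ( +-*-semiring; *-assoc; *-identityˡ; *-identityʳ; +-cancelˡ-≡
        ; m+n≡0⇒m≡0; m+n≡0⇒n≡0; ≤-total; m≤n⇒∃[o]m+o≡n; ∣m-n∣≡0⇒m≡n; ∣m-m+n∣≡n; ∣-∣-comm; >⇒≢ )
open import Data.Nat.Tactic.RingSolver using (solve-∀)
open import Data.Product using (_×_; Σ; _,_)
open import Data.Rational as ℚ using (ℚ; toℚᵘ; fromℚᵘ)
open import Data.Rational.Properties
  using (toℚᵘ-injective; toℚᵘ-fromℚᵘ; toℚᵘ-homo-+; toℚᵘ-homo-*; fromℚᵘ-cong; normalize-injective-≃; 0/n≡0)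
open import Data.Rational.Unnormalised as ℚᵘ using (mkℚᵘ; *≡*)
import Data.Rational.Unnormalised.Properties as ℚᵘ
open import Data.Sum using (inj₁; inj₂)
open import Function.Bundles using (_⇔_; mk⇔; Equivalence)
open import Function.Construct.Composition using (_⇔-∘_)
open import Relation.Binary.PropositionalEquality
open import Relation.Nullary using (¬_; contradiction)
open import Relation.Nullary.Decidable using (⌊_⌋; yes; no)

open import Algebra.Properties.Semiring.Sum +-*-semiring
  using (sum; sum-cong-≗; ∑-distrib-+; *-distribʳ-sum; sum-replicate-zero)

open Equivalence using (to; from)

∑-const : ∀ m c → sum {m} (λ _ → c) ≡ m * c
∑-const zero    c = refl
∑-const (suc m) c = cong (c +_) (∑-const m c)

∑≡0⇒≡0 : ∀ {m} (f : Fin m → ℕ) → sum f ≡ 0 → ∀ j → f j ≡ 0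
∑≡0⇒≡0 f eq zero    = m+n≡0⇒m≡0 (f zero) eq
∑≡0⇒≡0 f eq (suc j) = ∑≡0⇒≡0 (λ j → f (suc j)) (m+n≡0⇒n≡0 (f zero) eq) j

∑-*-balanced : ∀ {m t} (a b : Fin m → ℕ) → (∀ j → b j * m ≡ t) →
               sum (λ j → a j * b j) * m ≡ sum a * t
∑-*-balanced {m} {t} a b b*m≡t = begin
  sum (λ j → a j * b j) * m  ≡⟨ *-distribʳ-sum m (λ j → a j * b j) ⟩
  sum (λ j → a j * b j * m)  ≡⟨ sum-cong-≗ (λ j → trans (*-assoc (a j) (b j) m) (cong (a j *_) (b*m≡t j))) ⟩
  sum (λ j → a j * t)        ≡⟨ *-distribʳ-sum t a ⟨
  sum a * t                  ∎
  where open ≡-Reasoning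

x*x+y*y≡2xy+∣x-y∣² : ∀ x y → x * x + y * y ≡ 2 * x * y + ∣ x - y ∣ * ∣ x - y ∣
x*x+y*y≡2xy+∣x-y∣² x y with ≤-total x y
... | inj₁ x≤y with m≤n⇒∃[o]m+o≡n x≤y
...   | d , refl rewrite ∣m-m+n∣≡n x d = expand x d
  where expand : ∀ x d → x * x + (x + d) * (x + d) ≡ 2 * x * (x + d) + d * d
        expand = solve-∀
x*x+y*y≡2xy+∣x-y∣² x y | inj₂ y≤x with m≤n⇒∃[o]m+o≡n y≤x
...   | d , refl rewrite ∣-∣-comm (y + d) y | ∣m-m+n∣≡n y d = expand y d
  where expand : ∀ y d → (y + d) * (y + d) + y * y ≡ 2 * (y + d) * y + d * d
        expand = solve-∀

x*x≡0⇒x≡0 : ∀ x → x * x ≡ 0 → x ≡ 0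
x*x≡0⇒x≡0 zero _ = refl

∑a²*m≡[∑a]²⇒a*m≡∑a : ∀ {m} (a : Fin m → ℕ) →
                     sum (λ j → a j * a j) * m ≡ sum a * sum a → ∀ j → a j * m ≡ sum a
∑a²*m≡[∑a]²⇒a*m≡∑a {m} a ∑a²*m≡s*s j = ∣m-n∣≡0⇒m≡n (x*x≡0⇒x≡0 _ (∑≡0⇒≡0 D ∑D≡0 j))
  where
  open ≡-Reasoning
  s : ℕ
  s = sum a
  x D : Fin m → ℕ
  x j = a j * m
  D j = ∣ x j - s ∣ * ∣ x j - s ∣

  ∑x² : sum (λ j → x j * x j) ≡ s * s * m
  ∑x² = begin
    sum (λ j → x j * x j)          ≡⟨ sum-cong-≗ (λ j → regroup (a j) m) ⟩
    sum (λ j → a j * a j * m * m)  ≡⟨ *-distribʳ-sum m (λ j → a j * a j * m) ⟨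
    sum (λ j → a j * a j * m) * m  ≡⟨ cong (_* m) (*-distribʳ-sum m (λ j → a j * a j)) ⟨
    sum (λ j → a j * a j) * m * m  ≡⟨ cong (_* m) ∑a²*m≡s*s ⟩
    s * s * m                      ∎
    where regroup : ∀ a m → a * m * (a * m) ≡ a * a * m * m
          regroup = solve-∀

  ∑2xs : sum (λ j → 2 * x j * s) ≡ s * (2 * m * s)
  ∑2xs = begin
    sum (λ j → 2 * x j * s)        ≡⟨ sum-cong-≗ (λ j → regroup (a j) m s) ⟩
    sum (λ j → a j * (2 * m * s))  ≡⟨ *-distribʳ-sum (2 * m * s) a ⟨
    s * (2 * m * s)                ∎
    where regroup : ∀ a m s → 2 * (a * m) * s ≡ a * (2 * m * s)
          regroup = solve-∀

  ∑D≡0 : sum D ≡ 0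
  ∑D≡0 = +-cancelˡ-≡ (s * (2 * m * s)) (sum D) 0 (begin
    s * (2 * m * s) + sum D                        ≡⟨ cong (_+ sum D) ∑2xs ⟨
    sum (λ j → 2 * x j * s) + sum D                ≡⟨ ∑-distrib-+ (λ j → 2 * x j * s) D ⟨
    sum (λ j → 2 * x j * s + D j)                  ≡⟨ sum-cong-≗ (λ j → x*x+y*y≡2xy+∣x-y∣² (x j) s) ⟨
    sum (λ j → x j * x j + s * s)                  ≡⟨ ∑-distrib-+ {m} (λ j → x j * x j) (λ _ → s * s) ⟩
    sum (λ j → x j * x j) + sum {m} (λ _ → s * s)  ≡⟨ cong₂ _+_ ∑x² (∑-const m (s * s)) ⟩
    s * s * m + m * (s * s)                        ≡⟨ collect s m ⟩
    s * (2 * m * s) + 0                            ∎)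
    where collect : ∀ s m → s * s * m + m * (s * s) ≡ s * (2 * m * s) + 0
          collect = solve-∀

indicator : Bool → ℕ
indicator b = if b then 1 else 0

countF-cong : ∀ {n} {P Q : Fin n → Bool} → (∀ p → P p ≡ Q p) → countF P ≡ countF Q
countF-cong {zero}  eq = refl
countF-cong {suc n} eq = cong₂ _+_ (cong indicator (eq zero)) (countF-cong (λ p → eq (suc p)))

countF-true : ∀ n → countF {n} (λ _ → true) ≡ n
countF-true zero    = refl
countF-true (suc n) = cong suc (countF-true n)

⌊suc≟suc⌋ : ∀ {m} (c j : Fin m) → ⌊ suc c ≟ suc j ⌋ ≡ ⌊ c ≟ j ⌋
⌊suc≟suc⌋ c j with c ≟ j
... | yes _ = refl
... | no  _ = refl

∑-indicator-≟ : ∀ {m} (c : Fin m) → sum (λ j → indicator ⌊ c ≟ j ⌋) ≡ 1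
∑-indicator-≟ {suc m} zero    = cong suc (sum-replicate-zero m)
∑-indicator-≟ {suc m} (suc c) =
  trans (sum-cong-≗ (λ j → cong indicator (⌊suc≟suc⌋ c j))) (∑-indicator-≟ c)

∑-indicator-∧-≟ : ∀ {m} b (c : Fin m) → sum (λ j → indicator (b ∧ ⌊ c ≟ j ⌋)) ≡ indicator b
∑-indicator-∧-≟     true  c = ∑-indicator-≟ c
∑-indicator-∧-≟ {m} false c = sum-replicate-zero m

∑-countF-fibres : ∀ {n m} (Q : Fin n → Bool) (f : Fin n → Fin m) →
                  sum (λ j → countF (λ p → Q p ∧ ⌊ f p ≟ j ⌋)) ≡ countF Q
∑-countF-fibres {zero}  {m} Q f = sum-replicate-zero m
∑-countF-fibres {suc n}     Q f = trans
  (∑-distrib-+ (λ j → indicator (Q zero ∧ ⌊ f zero ≟ j ⌋)) _)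
  (cong₂ _+_ (∑-indicator-∧-≟ (Q zero) (f zero)) (∑-countF-fibres (λ p → Q (suc p)) (λ p → f (suc p))))

fromℚᵘ-homo-+ : ∀ p q → fromℚᵘ (p ℚᵘ.+ q) ≡ fromℚᵘ p ℚ.+ fromℚᵘ q
fromℚᵘ-homo-+ p q = toℚᵘ-injective (begin
  toℚᵘ (fromℚᵘ (p ℚᵘ.+ q))              ≈⟨ toℚᵘ-fromℚᵘ (p ℚᵘ.+ q) ⟩
  p ℚᵘ.+ q                               ≈⟨ ℚᵘ.+-cong (toℚᵘ-fromℚᵘ p) (toℚᵘ-fromℚᵘ q) ⟨
  toℚᵘ (fromℚᵘ p) ℚᵘ.+ toℚᵘ (fromℚᵘ q)  ≈⟨ toℚᵘ-homo-+ (fromℚᵘ p) (fromℚᵘ q) ⟨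
  toℚᵘ (fromℚᵘ p ℚ.+ fromℚᵘ q)          ∎)
  where open ℚᵘ.≃-Reasoning

fromℚᵘ-homo-* : ∀ p q → fromℚᵘ (p ℚᵘ.* q) ≡ fromℚᵘ p ℚ.* fromℚᵘ q
fromℚᵘ-homo-* p q = toℚᵘ-injective (begin
  toℚᵘ (fromℚᵘ (p ℚᵘ.* q))              ≈⟨ toℚᵘ-fromℚᵘ (p ℚᵘ.* q) ⟩
  p ℚᵘ.* q                               ≈⟨ ℚᵘ.*-cong (toℚᵘ-fromℚᵘ p) (toℚᵘ-fromℚᵘ q) ⟨
  toℚᵘ (fromℚᵘ p) ℚᵘ.* toℚᵘ (fromℚᵘ q)  ≈⟨ toℚᵘ-homo-* (fromℚᵘ p) (fromℚᵘ q) ⟨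
  toℚᵘ (fromℚᵘ p ℚ.* fromℚᵘ q)          ∎)
  where open ℚᵘ.≃-Reasoning

frac-≡⇔ : ∀ {a b c d} → 0 < b → 0 < d → (frac a b ≡ frac c d ⇔ a * d ≡ c * b)
frac-≡⇔ {a} {suc b} {c} {suc d} _ _ = mk⇔
  (normalize-injective-≃ a c (suc b) (suc d))
  (λ eq → fromℚᵘ-cong {mkℚᵘ (ℤ.+ a) b} {mkℚᵘ (ℤ.+ c) d}
            (*≡* (trans (sym (pos-* a (suc d))) (trans (cong ℤ.+_ eq) (pos-* c (suc b))))))

frac-+ : ∀ a b d → frac a (suc d) ℚ.+ frac b (suc d) ≡ frac (a + b) (suc d)
frac-+ a b d = trans (sym (fromℚᵘ-homo-+ (mkℚᵘ (ℤ.+ a) d) (mkℚᵘ (ℤ.+ b) d)))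
  (fromℚᵘ-cong {mkℚᵘ (ℤ.+ a) d ℚᵘ.+ mkℚᵘ (ℤ.+ b) d} {mkℚᵘ (ℤ.+ (a + b)) d}
    (*≡* (trans (common-denominator (ℤ.+ a) (ℤ.+ b) (ℤ.+ suc d))
                (cong₂ ℤ._*_ (sym (pos-+ a b)) (sym (pos-* (suc d) (suc d)))))))
  where common-denominator : ∀ a b d → (a ℤ.* d ℤ.+ b ℤ.* d) ℤ.* d ≡ (a ℤ.+ b) ℤ.* (d ℤ.* d)
        common-denominator = ℤ-Solver.solve-∀

frac-* : ∀ a b c d → frac a (suc b) ℚ.* frac c (suc d) ≡ frac (a * c) (suc b * suc d)
frac-* a b c d = trans (sym (fromℚᵘ-homo-* (mkℚᵘ (ℤ.+ a) b) (mkℚᵘ (ℤ.+ c) d)))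
  (fromℚᵘ-cong {mkℚᵘ (ℤ.+ a) b ℚᵘ.* mkℚᵘ (ℤ.+ c) d} {mkℚᵘ (ℤ.+ (a * c)) (d + b * suc d)}
    (*≡* (cong₂ ℤ._*_ (sym (pos-* a c)) (pos-* (suc b) (suc d)))))

sumQ-frac : ∀ {m} d (f : Fin m → ℕ) → sumQ (λ j → frac (f j) (suc d)) ≡ frac (sum f) (suc d)
sumQ-frac {zero}  d f = sym (0/n≡0 (suc d))
sumQ-frac {suc m} d f =
  trans (cong (frac (f zero) (suc d) ℚ.+_) (sumQ-frac d (λ j → f (suc j)))) (frac-+ (f zero) _ d)

sumQ-frac-* : ∀ {m s t} (a b : Fin m → ℕ) → 0 < s → 0 < t →
              sumQ (λ j → frac (a j) s ℚ.* frac (b j) t) ≡ frac (sum (λ j → a j * b j)) (s * t)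
sumQ-frac-* {s = suc s} {suc t} a b _ _ =
  trans (sumQ-cong (λ j → frac-* (a j) s (b j) t)) (sumQ-frac _ (λ j → a j * b j))
  where sumQ-cong : ∀ {m} {f g : Fin m → ℚ} → (∀ j → f j ≡ g j) → sumQ f ≡ sumQ g
        sumQ-cong {zero}  eq = refl
        sumQ-cong {suc m} eq = cong₂ ℚ._+_ (eq zero) (sumQ-cong (λ j → eq (suc j)))

sumQ-frac-*≡frac1⇔ : ∀ {m s t} (a b : Fin m → ℕ) → 0 < m → 0 < s → 0 < t →
  (sumQ (λ j → frac (a j) s ℚ.* frac (b j) t) ≡ frac 1 m ⇔ sum (λ j → a j * b j) * m ≡ s * t)
sumQ-frac-*≡frac1⇔ {m} {suc s} {suc t} a b 0<m 0<s 0<t = mk⇔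
  (λ eq → trans (to cross (trans (sym sum≡frac) eq)) (*-identityˡ _))
  (λ eq → trans sum≡frac (from cross (trans eq (sym (*-identityˡ _)))))
  where
  sum≡frac : sumQ (λ j → frac (a j) (suc s) ℚ.* frac (b j) (suc t))
             ≡ frac (sum (λ j → a j * b j)) (suc s * suc t)
  sum≡frac = sumQ-frac-* a b 0<s 0<t
  cross : (frac (sum (λ j → a j * b j)) (suc s * suc t) ≡ frac 1 m
           ⇔ sum (λ j → a j * b j) * m ≡ 1 * (suc s * suc t))
  cross = frac-≡⇔ {sum (λ j → a j * b j)} {suc s * suc t} {1} {m} z<s 0<m

∣-pos⇒pos : ∀ {d s} → 0 < s → d ∣ s → 0 < d
∣-pos⇒pos {zero}  0<s 0∣s = contradiction (0∣⇒≡0 0∣s) (>⇒≢ 0<s)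
∣-pos⇒pos {suc d} _   _   = z<s

module _ {n k m : ℕ} (g : Fin n → Fin k) (h : Fin n → Fin m) where
  open Hashing g h

  ∑ⱼα≡size : ∀ i → sum (α i) ≡ size i
  ∑ⱼα≡size i = ∑-countF-fibres (λ p → ⌊ g p ≟ i ⌋) h

  ∑ᵢα≡nb : ∀ j → sum (λ i → α i j) ≡ nb j
  ∑ᵢα≡nb j = trans
    (sum-cong-≗ (λ i → countF-cong (λ p → ∧-comm ⌊ g p ≟ i ⌋ ⌊ h p ≟ j ⌋)))
    (∑-countF-fibres (λ p → ⌊ h p ≟ j ⌋) g)

  ∑size≡n : sum size ≡ n
  ∑size≡n = trans (∑-countF-fibres (λ _ → true) g) (countF-true n)

  ∑nb≡n : sum nb ≡ n
  ∑nb≡n = trans (∑-countF-fibres (λ _ → true) h) (countF-true n)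

  Balanced : Set
  Balanced = ∀ i j → α i j * m ≡ size i

  pairwiseFair⇔balanced : 0 < m → (∀ i → 0 < size i) → (PairwiseFair ⇔ Balanced)
  pairwiseFair⇔balanced 0<m 0<size = mk⇔
    (λ fair i j → trans (∑a²*m≡[∑a]²⇒a*m≡∑a (α i) (∑α²*m≡[∑α]² fair i) j) (∑ⱼα≡size i))
    (λ bal i → from (pairwise⇔ i)
      (trans (∑-*-balanced (α i) (α i) (bal i)) (cong (_* size i) (∑ⱼα≡size i))))
    where
    pairwise⇔ : ∀ i → (sumQ (λ j → frac (α i j) (size i) ℚ.* frac (α i j) (size i)) ≡ frac 1 m
                        ⇔ sum (λ j → α i j * α i j) * m ≡ size i * size i)
    pairwise⇔ i = sumQ-frac-*≡frac1⇔ (α i) (α i) 0<m (0<size i) (0<size i)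
    ∑α²*m≡[∑α]² : PairwiseFair → ∀ i → sum (λ j → α i j * α i j) * m ≡ sum (α i) * sum (α i)
    ∑α²*m≡[∑α]² fair i =
      trans (to (pairwise⇔ i) (fair i)) (sym (cong₂ _*_ (∑ⱼα≡size i) (∑ⱼα≡size i)))

  balanced⇔frac≡frac : 0 < m → (Balanced ⇔ (∀ i j → frac (α i j) 1 ≡ frac (size i) m))
  balanced⇔frac≡frac 0<m = mk⇔
    (λ bal i j → from (cross i j) (trans (bal i j) (sym (*-identityʳ (size i)))))
    (λ eq i j → trans (to (cross i j) (eq i j)) (*-identityʳ (size i)))
    where
    cross : ∀ i j → (frac (α i j) 1 ≡ frac (size i) m ⇔ α i j * m ≡ size i * 1)
    cross i j = frac-≡⇔ {α i j} {1} {size i} {m} z<s 0<m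

  balanced⇒nb*m≡n : Balanced → ∀ j → nb j * m ≡ n
  balanced⇒nb*m≡n bal j = begin
    nb j * m                   ≡⟨ cong (_* m) (∑ᵢα≡nb j) ⟨
    sum (λ i → α i j) * m      ≡⟨ *-distribʳ-sum m (λ i → α i j) ⟩
    sum (λ i → α i j * m)      ≡⟨ sum-cong-≗ (λ i → bal i j) ⟩
    sum size                   ≡⟨ ∑size≡n ⟩
    n                          ∎
    where open ≡-Reasoning

  balanced⇒singleFair : 0 < n → 0 < m → (∀ i → 0 < size i) → Balanced → SingleFair
  balanced⇒singleFair 0<n 0<m 0<size bal i =
    from (sumQ-frac-*≡frac1⇔ (α i) nb 0<m (0<size i) 0<n)
      (trans (∑-*-balanced (α i) nb (balanced⇒nb*m≡n bal)) (cong (_* n) (∑ⱼα≡size i)))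

  balanced⇒collisionProb : 0 < n → 0 < m → Balanced → CollisionProb
  balanced⇒collisionProb 0<n 0<m bal =
    from (sumQ-frac-*≡frac1⇔ nb nb 0<m 0<n 0<n)
      (trans (∑-*-balanced nb nb (balanced⇒nb*m≡n bal)) (cong (_* n) ∑nb≡n))

  pairwiseFair-properties : 0 < n → (∀ i → 0 < size i) → (∀ i → m ∣ size i) →
    (PairwiseFair ⇔ (∀ i j → frac (α i j) 1 ≡ frac (size i) m))
    × (PairwiseFair → SingleFair × CollisionProb)
  pairwiseFair-properties 0<n 0<size m∣size =
      balanced⇔frac≡frac 0<m ⇔-∘ fair⇔bal
    , λ fair → balanced⇒singleFair 0<n 0<m 0<size (to fair⇔bal fair)
             , balanced⇒collisionProb 0<n 0<m (to fair⇔bal fair)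
    where
    -- m ∣ size i only serves to exclude m = 0, where frac 1 m is the junk value 0.
    0<m : 0 < m
    0<m = ∣-pos⇒pos (0<size (g (fromℕ< 0<n))) (m∣size (g (fromℕ< 0<n)))
    fair⇔bal : PairwiseFair ⇔ Balanced
    fair⇔bal = pairwiseFair⇔balanced 0<m 0<size

twoPairs : Fin 4 → Fin 2
twoPairs 0F = 0F
twoPairs 1F = 0F
twoPairs 2F = 1F
twoPairs 3F = 1F

twoPairs-counterexample :
  let open Hashing twoPairs twoPairs in
  (∀ i → 0 < size i) × (∀ i → 2 ∣ size i) × CollisionProb × SingleFair × ¬ PairwiseFair
twoPairs-counterexample = 0<size , (λ { 0F → divides 1 refl ; 1F → divides 1 refl })
                        , refl , (λ { 0F → refl ; 1F → refl })
                        -- group 0F has no point in bucket 1F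
                        , λ fair → contradiction
                            (to (pairwiseFair⇔balanced twoPairs twoPairs z<s 0<size) fair 0F 1F) λ ()
  where
  0<size : ∀ i → 0 < Hashing.size twoPairs twoPairs i
  0<size 0F = z<s
  0<size 1F = z<s

proposition2p3 :
    (∀ (n k m : ℕ) (g : Fin n → Fin k) (h : Fin n → Fin m) →
       0 < n →
       (∀ i → 0 < Hashing.size g h i) →
       (∀ i → m ∣ Hashing.size g h i) →
       (Hashing.PairwiseFair g h ⇔
          (∀ i j → frac (Hashing.α g h i j) 1 ≡ frac (Hashing.size g h i) m))
       × (Hashing.PairwiseFair g h → Hashing.SingleFair g h × Hashing.CollisionProb g h))
    × (Σ ℕ λ n → Σ ℕ λ k → Σ ℕ λ m → Σ (Fin n → Fin k) λ g → Σ (Fin n → Fin m) λ h →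
         (0 < n) × (∀ i → 0 < Hashing.size g h i) × (∀ i → m ∣ Hashing.size g h i)
         × Hashing.CollisionProb g h × Hashing.SingleFair g h × ¬ Hashing.PairwiseFair g h)
proposition2p3 = (λ n k m → pairwiseFair-properties)
               , (4 , 2 , 2 , twoPairs , twoPairs , z<s , twoPairs-counterexample)
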